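{- Let $S$ be an S-tree. Then $\operatorname{Core}(S)=V(S)\setminus\operatorname{Supp}(S)$.
   Context: For a tree $S$, $\mathcal{N}(S)$ is the null space of its adjacency matrix and $\operatorname{Supp}(S)=\{w\in V(S): x_w\neq0\text{ for some }x\in\mathcal{N}(S)\}$. $S$ is an S-tree if $N[\operatorname{Supp}(S)]=V(S)$, where $N[X]=\bigcup_{w\in X}(N(w)\cup\{w\})$. $\operatorname{Core}(S)=\bigcup_{w\in\operatorname{Supp}(S)}N(w)$.
   Formalization: The null space $\mathcal{N}(S)$ defining $\operatorname{Supp}(S)$ consists of rational vectors rather than real ones. -}

module Defs where

open import Data.Nat using (ℕ; zero; suc; _∸_; _≤_; _<ᵇ_)
open import Data.Bool using (Bool; true; false; _∧_; if_then_else_)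
open import Data.Fin using (Fin; zero; suc; toℕ)
open import Data.List using (List; allFin; concatMap; map)
open import Data.Nat.ListAction using (sum)
open import Data.Rational using (ℚ; 0ℚ; 1ℚ; _+_; _*_)
open import Data.Product using (Σ; ∃; _×_; _,_)
open import Data.Sum using (_⊎_)
open import Relation.Nullary using (¬_)
open import Relation.Binary.PropositionalEquality using (_≡_; _≢_)
open import Relation.Binary.Construct.Closure.ReflexiveTransitive using (Star)

record Graph (n : ℕ) : Set where
  field
    adj    : Fin n → Fin n → Bool
    sym    : ∀ i j → adj i j ≡ adj j i
    irrefl : ∀ i → adj i i ≡ false
open Graph public

Adj : ∀ {n} → Graph n → Fin n → Fin n → Set
Adj G i j = adj G i j ≡ true

edgeCount : ∀ {n} → Graph n → ℕ
edgeCount {n} G =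
  sum (concatMap (λ i → map (λ j → if (toℕ i <ᵇ toℕ j) ∧ adj G i j then 1 else 0)
                            (allFin n))
                 (allFin n))

Connected : ∀ {n} → Graph n → Set
Connected {n} G = ∀ (u v : Fin n) → Star (Adj G) u v

IsTree : ∀ {n} → Graph n → Set
IsTree {n} G = (1 ≤ n) × Connected G × (edgeCount G ≡ n ∸ 1)

sumℚ : ∀ {n} → (Fin n → ℚ) → ℚ
sumℚ {zero}  f = 0ℚ
sumℚ {suc n} f = f zero + sumℚ (λ i → f (suc i))

adjMatrix : ∀ {n} → Graph n → Fin n → Fin n → ℚ
adjMatrix G i j = if adj G i j then 1ℚ else 0ℚ

InNullSpace : ∀ {n} → Graph n → (Fin n → ℚ) → Set
InNullSpace G x = ∀ i → sumℚ (λ j → adjMatrix G i j * x j) ≡ 0ℚ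

InSupp : ∀ {n} → Graph n → Fin n → Set
InSupp G w = Σ (_ → ℚ) (λ x → InNullSpace G x × x w ≢ 0ℚ)

InClosedNbhdSupp : ∀ {n} → Graph n → Fin n → Set
InClosedNbhdSupp G v = ∃ λ w → InSupp G w × (v ≡ w ⊎ Adj G w v)

IsSTree : ∀ {n} → Graph n → Set
IsSTree {n} G = IsTree G × (∀ (v : Fin n) → InClosedNbhdSupp G v)

InCore : ∀ {n} → Graph n → Fin n → Set
InCore G v = ∃ λ w → InSupp G w × Adj G w v

-- Every vertex outside Supp(S) lies in N[Supp(S)] = V(S), hence is a neighbour of Supp(S),
-- i.e. lies in Core(S).  Conversely it suffices that Supp(S) is an independent set, which
-- rests on a fact about trees:
--
--   (⋆) a symmetric weighting g of the pairs of vertices of a tree whose edge weights sum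
--       to zero around every vertex vanishes on every edge.
--
-- Applied to g(i,j) = z_i z_j for a null vector z (around i the weights sum to z_i (Az)_i = 0)
-- it shows that z vanishes at one end of each edge; adding two null vectors then shows that
-- adjacent vertices cannot both lie in Supp(S).
--
-- (⋆) is proved by deleting leaves: balance at a leaf forces its edge weight to be zero, and
-- the remaining weights stay balanced.  Trees are given by connectivity and an edge count,
-- so the induction runs over connected vertex sets L with |L| = k + 1 and k inner edges;
-- the degree count (handshake lemma) provides a vertex of degree at most one.

module Submission where

open import Defs
open import Data.Nat using (ℕ)
open import Data.Fin using (Fin)
open import Data.Product using (_×_)
open import Relation.Nullary using (¬_)

open import Algebra.Bundles using (Monoid; CommutativeMonoid; Semiring; CommutativeRing)
import Algebra.Properties.CommutativeMonoid.Sum as CommutativeMonoidSum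
import Algebra.Properties.CommutativeSemigroup as CommutativeSemigroupProperties
import Algebra.Properties.Semiring.Sum as SemiringSum
open import Data.Bool using (Bool; true; false; _∧_; if_then_else_)
open import Data.Bool.Properties using (∧-zeroʳ; ∧-conicalˡ; ∧-conicalʳ; ¬-not; T-≡)
  renaming (_≟_ to _≟ᵇ_)
open import Data.Empty using (⊥; ⊥-elim)
open import Data.Fin using (zero; suc; toℕ; _≟_)
open import Data.Fin.Properties using (any?; suc-injective; toℕ-injective)
open import Data.List using (List; map; concatMap; tabulate)
open import Data.List.Properties using (map-tabulate)
import Data.Nat.ListAction as List
open import Data.Nat.ListAction.Properties using (sum-++)
open import Data.Nat using (zero; suc; _+_; _≤_; _<_; z≤n; s≤s; _<ᵇ_; _≤?_)
import Data.Nat.Properties as ℕP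
open import Data.Product using (∃; _,_)
open import Data.Rational using (ℚ; 0ℚ; 1ℚ; 1/_; ≢-nonZero)
  renaming (_+_ to _+ℚ_; _*_ to _*ℚ_; _≟_ to _≟ℚ_)
import Data.Rational.Properties as ℚP
open import Data.Sum using (inj₁; inj₂)
open import Function using (_∘_; id; Equivalence)
open import Relation.Binary.Construct.Closure.ReflexiveTransitive as Star using (Star; ε; _◅_)
open import Relation.Binary.Definitions using (tri<; tri≈; tri>)
open import Relation.Binary.PropositionalEquality as Eq
  using (_≡_; _≢_; refl; cong; cong₂; trans; subst; module ≡-Reasoning)
open import Relation.Nullary using (yes; no; does; ¬?; _×-dec_)
open import Relation.Nullary.Decidable using (dec-true; dec-false)

module MonoidSums {a ℓ} (M : Monoid a ℓ) where
  open Monoid M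
    using (Carrier; _≈_; ∙-cong; ∙-congˡ; ∙-congʳ; identityˡ; identityʳ)
    renaming (ε to 0#; refl to ≈-refl; trans to ≈-trans)
  open import Algebra.Properties.Monoid.Sum M using (sum)

  sum-zero : ∀ {n} (f : Fin n → Carrier) → (∀ i → f i ≈ 0#) → sum f ≈ 0#
  sum-zero {zero}  f f≈0 = ≈-refl
  sum-zero {suc n} f f≈0 =
    ≈-trans (∙-cong (f≈0 zero) (sum-zero (f ∘ suc) (f≈0 ∘ suc))) (identityˡ 0#)

  sum-single : ∀ {n} (k : Fin n) (f : Fin n → Carrier) →
               (∀ i → i ≢ k → f i ≈ 0#) → sum f ≈ f k
  sum-single zero f off =
    ≈-trans (∙-congˡ (sum-zero (f ∘ suc) (λ i → off (suc i) λ ()))) (identityʳ (f zero))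
  sum-single (suc k) f off =
    ≈-trans (∙-congʳ (off zero λ ()))
      (≈-trans (identityˡ _) (sum-single k (f ∘ suc) (λ i i≢k → off (suc i) (i≢k ∘ suc-injective))))

open CommutativeMonoidSum ℕP.+-0-commutativeMonoid
  using (∑-distrib-+; ∑-comm) renaming (sum to ∑; sum-cong-≗ to ∑-cong)
open MonoidSums (CommutativeMonoid.monoid ℕP.+-0-commutativeMonoid)
  renaming (sum-zero to ∑-zero; sum-single to ∑-single)
open CommutativeSemigroupProperties ℕP.+-commutativeSemigroup using (x∙yz≈y∙xz)

∑-ones : ∀ m → ∑ {m} (λ _ → 1) ≡ m
∑-ones zero    = refl
∑-ones (suc m) = cong suc (∑-ones m)

∑-mono-≤ : ∀ {n} {f g : Fin n → ℕ} → (∀ i → f i ≤ g i) → ∑ f ≤ ∑ g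
∑-mono-≤ {zero}  f≤g = z≤n
∑-mono-≤ {suc n} f≤g = ℕP.+-mono-≤ (f≤g zero) (∑-mono-≤ (f≤g ∘ suc))

term-≤-∑ : ∀ {n} (k : Fin n) (f : Fin n → ℕ) → f k ≤ ∑ f
term-≤-∑ zero    f = ℕP.m≤m+n (f zero) _
term-≤-∑ (suc k) f = ℕP.≤-trans (term-≤-∑ k (f ∘ suc)) (ℕP.m≤n+m _ (f zero))

two-terms-≤-∑ : ∀ {n} {k l : Fin n} (f : Fin n → ℕ) → k ≢ l → f k + f l ≤ ∑ f
two-terms-≤-∑ {k = zero}  {zero}  f k≢l = ⊥-elim (k≢l refl)
two-terms-≤-∑ {k = zero}  {suc l} f k≢l = ℕP.+-monoʳ-≤ (f zero) (term-≤-∑ l (f ∘ suc))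
two-terms-≤-∑ {k = suc k} {zero}  f k≢l =
  ℕP.≤-trans (ℕP.≤-reflexive (ℕP.+-comm (f (suc k)) (f zero)))
             (ℕP.+-monoʳ-≤ (f zero) (term-≤-∑ k (f ∘ suc)))
two-terms-≤-∑ {k = suc k} {suc l} f k≢l =
  ℕP.≤-trans (two-terms-≤-∑ (f ∘ suc) (k≢l ∘ cong suc)) (ℕP.m≤n+m _ (f zero))

∑-bump : ∀ {n} (k : Fin n) (c : ℕ) (f g : Fin n → ℕ) →
         (∀ i → i ≢ k → f i ≡ g i) → f k ≡ c + g k → ∑ f ≡ c + ∑ g
∑-bump zero c f g off at-k = begin
    f zero + ∑ (f ∘ suc)     ≡⟨ cong₂ _+_ at-k (∑-cong (λ i → off (suc i) λ ())) ⟩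
    (c + g zero) + ∑ (g ∘ suc) ≡⟨ ℕP.+-assoc c (g zero) _ ⟩
    c + ∑ g                  ∎
  where open ≡-Reasoning
∑-bump (suc k) c f g off at-k = begin
    f zero + ∑ (f ∘ suc)       ≡⟨ cong₂ _+_ (off zero λ ())
                                    (∑-bump k c (f ∘ suc) (g ∘ suc)
                                       (λ i i≢k → off (suc i) (i≢k ∘ suc-injective)) at-k) ⟩
    g zero + (c + ∑ (g ∘ suc)) ≡⟨ x∙yz≈y∙xz (g zero) c _ ⟩
    c + ∑ g                    ∎
  where open ≡-Reasoning

ℚ-semiring : Semiring _ _
ℚ-semiring = CommutativeRing.semiring ℚP.+-*-commutativeRing

module Σℚ = SemiringSum ℚ-semiring
open MonoidSums (CommutativeMonoid.monoid (Semiring.+-commutativeMonoid ℚ-semiring))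
  using () renaming (sum-single to ∑ℚ-single)

sumℚ≡∑ : ∀ {n} (f : Fin n → ℚ) → sumℚ f ≡ Σℚ.sum f
sumℚ≡∑ {zero}  f = refl
sumℚ≡∑ {suc n} f = cong (f zero +ℚ_) (sumℚ≡∑ (f ∘ suc))

Symmetric : ∀ {n} → (Fin n → Fin n → ℚ) → Set
Symmetric g = ∀ i j → g i j ≡ g j i

VertexSet : ℕ → Set
VertexSet n = Fin n → Bool

_∈_ : ∀ {n} → Fin n → VertexSet n → Set
i ∈ L = L i ≡ true

full : ∀ {n} → VertexSet n
full _ = true

_─_ : ∀ {n} → VertexSet n → Fin n → VertexSet n
(L ─ ℓ) i = if does (i ≟ ℓ) then false else L i

module Deletion {n : ℕ} (L : VertexSet n) (ℓ : Fin n) where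

  ─-self : (L ─ ℓ) ℓ ≡ false
  ─-self rewrite dec-true (ℓ ≟ ℓ) refl = refl

  ─-other : ∀ {i} → i ≢ ℓ → (L ─ ℓ) i ≡ L i
  ─-other {i} i≢ℓ rewrite dec-false (i ≟ ℓ) i≢ℓ = refl

  ∈-─ : ∀ {i} → i ≢ ℓ → i ∈ L → i ∈ (L ─ ℓ)
  ∈-─ i≢ℓ i∈L = trans (─-other i≢ℓ) i∈L

  ∈-─⁻ : ∀ {i} → i ∈ (L ─ ℓ) → i ≢ ℓ × i ∈ L
  ∈-─⁻ {i} i∈L─ℓ = i≢ℓ , trans (Eq.sym (─-other i≢ℓ)) i∈L─ℓ
    where
    i≢ℓ : i ≢ ℓ
    i≢ℓ refl with () ← trans (Eq.sym ─-self) i∈L─ℓ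

<ᵇ-true : ∀ {m n} → m < n → (m <ᵇ n) ≡ true
<ᵇ-true m<n = Equivalence.to T-≡ (ℕP.<⇒<ᵇ m<n)

<ᵇ-false : ∀ {m n} → n ≤ m → (m <ᵇ n) ≡ false
<ᵇ-false {m} {n} n≤m = ¬-not (λ m<ᵇn → ℕP.<⇒≱ (ℕP.<ᵇ⇒< m n (Equivalence.from T-≡ m<ᵇn)) n≤m)

listSum-tabulate : ∀ {m} (f : Fin m → ℕ) → List.sum (tabulate f) ≡ ∑ f
listSum-tabulate {zero}  f = refl
listSum-tabulate {suc m} f = cong (f zero +_) (listSum-tabulate (f ∘ suc))

listSum-concatMap : ∀ {m} {A : Set} (F : A → List ℕ) (g : Fin m → A) →
                    List.sum (concatMap F (tabulate g)) ≡ ∑ (λ i → List.sum (F (g i)))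
listSum-concatMap {zero}  F g = refl
listSum-concatMap {suc m} F g =
  trans (sum-++ (F (g zero)) (concatMap F (tabulate (g ∘ suc))))
        (cong (List.sum (F (g zero)) +_) (listSum-concatMap F (g ∘ suc)))

⟦_⟧ : Bool → ℕ
⟦ b ⟧ = if b then 1 else 0

module _ {n : ℕ} (G : Graph n) where

  size : VertexSet n → ℕ
  size L = ∑ (λ i → ⟦ L i ⟧)

  deg : VertexSet n → Fin n → ℕ
  deg L i = ∑ (λ j → ⟦ L j ∧ adj G i j ⟧)

  row : VertexSet n → Fin n → ℕ
  row L i = ∑ (λ j → ⟦ L i ∧ L j ∧ adj G i j ⟧)

  -- twice the number of edges with both ends in L
  vol : VertexSet n → ℕ
  vol L = ∑ (row L)

  EdgeIn : VertexSet n → Fin n → Fin n → Set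
  EdgeIn L x y = x ∈ L × y ∈ L × Adj G x y

  ConnectedIn : VertexSet n → Set
  ConnectedIn L = ∀ {u v} → u ∈ L → v ∈ L → Star (EdgeIn L) u v

  flow : VertexSet n → (Fin n → Fin n → ℚ) → Fin n → ℚ
  flow L g i = Σℚ.sum (λ j → if L j ∧ adj G i j then g i j else 0ℚ)

  Balanced : VertexSet n → (Fin n → Fin n → ℚ) → Set
  Balanced L g = ∀ {i} → i ∈ L → flow L g i ≡ 0ℚ

  VanishesOnEdgesIn : VertexSet n → (Fin n → Fin n → ℚ) → Set
  VanishesOnEdgesIn L g = ∀ {x y} → x ∈ L → y ∈ L → Adj G x y → g x y ≡ 0ℚ

  adjacent-distinct : ∀ {x y} → Adj G x y → x ≢ y
  adjacent-distinct {x} xx refl with () ← trans (Eq.sym (irrefl G x)) xx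

  -- Handshake lemma: the degrees of G sum to twice its number of edges.
  -- Each edge is counted once in each orientation, and edgeCount counts the ascending one.
  ascending : Fin n → Fin n → ℕ
  ascending i j = ⟦ (toℕ i <ᵇ toℕ j) ∧ adj G i j ⟧

  edge-orientations : ∀ i j → ⟦ adj G i j ⟧ ≡ ascending i j + ascending j i
  edge-orientations i j rewrite sym G j i with ℕP.<-cmp (toℕ i) (toℕ j)
  ... | tri< i<j _ _ rewrite <ᵇ-true i<j | <ᵇ-false (ℕP.<⇒≤ i<j) =
    Eq.sym (ℕP.+-identityʳ _)
  ... | tri> _ _ j<i rewrite <ᵇ-true j<i | <ᵇ-false (ℕP.<⇒≤ j<i) = refl
  ... | tri≈ _ i≡j _ with refl ← toℕ-injective i≡j
    rewrite irrefl G i | ∧-zeroʳ (toℕ i <ᵇ toℕ i) = refl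

  edgeCount-∑ : edgeCount G ≡ ∑ (λ i → ∑ (ascending i))
  edgeCount-∑ = begin
      List.sum (concatMap (λ i → map (ascending i) (tabulate id)) (tabulate id))
    ≡⟨ listSum-concatMap (λ i → map (ascending i) (tabulate id)) id ⟩
      ∑ (λ i → List.sum (map (ascending i) (tabulate id)))
    ≡⟨ ∑-cong (λ i → trans (cong List.sum (map-tabulate id (ascending i)))
                           (listSum-tabulate (ascending i))) ⟩
      ∑ (λ i → ∑ (ascending i))
    ∎
    where open ≡-Reasoning

  handshake : vol full ≡ edgeCount G + edgeCount G
  handshake = begin
      ∑ (λ i → ∑ (λ j → ⟦ adj G i j ⟧))
    ≡⟨ ∑-cong (λ i → ∑-cong (edge-orientations i)) ⟩
      ∑ (λ i → ∑ (λ j → ascending i j + ascending j i))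
    ≡⟨ ∑-cong (λ i → ∑-distrib-+ (ascending i) (λ j → ascending j i)) ⟩
      ∑ (λ i → ∑ (ascending i) + ∑ (λ j → ascending j i))
    ≡⟨ ∑-distrib-+ (λ i → ∑ (ascending i)) (λ i → ∑ (λ j → ascending j i)) ⟩
      ∑ (λ i → ∑ (ascending i)) + ∑ (λ i → ∑ (λ j → ascending j i))
    ≡⟨ cong (∑ (λ i → ∑ (ascending i)) +_) (∑-comm (λ i j → ascending j i)) ⟩
      ∑ (λ i → ∑ (ascending i)) + ∑ (λ i → ∑ (ascending i))
    ≡⟨ Eq.sym (cong₂ _+_ edgeCount-∑ edgeCount-∑) ⟩
      edgeCount G + edgeCount G
    ∎
    where open ≡-Reasoning

  record Leaf (L : VertexSet n) : Set where
    field
      leaf stem  : Fin n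
      leaf∈      : leaf ∈ L
      stem∈      : stem ∈ L
      leaf-stem  : Adj G leaf stem
      only-stem  : ∀ {x} → x ∈ L → Adj G leaf x → x ≡ stem

  degrees-≥2 : ∀ L → (∀ {i} → i ∈ L → 2 ≤ deg L i) → size L + size L ≤ vol L
  degrees-≥2 L deg≥2 = begin
      size L + size L                      ≡⟨ ∑-distrib-+ (λ i → ⟦ L i ⟧) (λ i → ⟦ L i ⟧) ⟨
      ∑ (λ i → ⟦ L i ⟧ + ⟦ L i ⟧)          ≤⟨ ∑-mono-≤ row≥2 ⟩
      vol L                                ∎
    where
    open ℕP.≤-Reasoning
    row≥2 : ∀ i → ⟦ L i ⟧ + ⟦ L i ⟧ ≤ ∑ (λ j → ⟦ L i ∧ L j ∧ adj G i j ⟧)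
    row≥2 i with L i in i∈L
    ... | false = z≤n
    ... | true  = deg≥2 i∈L

  low-degree-vertex : ∀ L → vol L < size L + size L → ∃ λ ℓ → ℓ ∈ L × deg L ℓ ≤ 1
  low-degree-vertex L few-edges with any? (λ i → (L i ≟ᵇ true) ×-dec (deg L i ≤? 1))
  ... | yes found = found
  ... | no none = ⊥-elim (ℕP.<⇒≱ few-edges (degrees-≥2 L deg≥2))
    where
    deg≥2 : ∀ {i} → i ∈ L → 2 ≤ deg L i
    deg≥2 {i} i∈L = ℕP.≰⇒> (λ deg≤1 → none (i , i∈L , deg≤1))

  another-member : ∀ L → 2 ≤ size L → ∀ ℓ → ∃ λ u → u ∈ L × u ≢ ℓ
  another-member L two ℓ with any? (λ i → (L i ≟ᵇ true) ×-dec ¬? (i ≟ ℓ))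
  ... | yes found = found
  ... | no none = ⊥-elim (ℕP.<⇒≱ two (subst (_≤ 1) (Eq.sym size≡) (⟦⟧≤1 (L ℓ))))
    where
    ⟦⟧≤1 : ∀ b → ⟦ b ⟧ ≤ 1
    ⟦⟧≤1 true  = ℕP.≤-refl
    ⟦⟧≤1 false = z≤n
    outside-ℓ : ∀ i → i ≢ ℓ → ⟦ L i ⟧ ≡ 0
    outside-ℓ i i≢ℓ with L i in i∈L
    ... | true  = ⊥-elim (none (i , i∈L , i≢ℓ))
    ... | false = refl
    size≡ : size L ≡ ⟦ L ℓ ⟧
    size≡ = ∑-single ℓ (λ i → ⟦ L i ⟧) outside-ℓ

  unique-neighbour : ∀ L {ℓ p x} → deg L ℓ ≤ 1 → p ∈ L → Adj G ℓ p → x ∈ L → Adj G ℓ x → x ≡ p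
  unique-neighbour L {ℓ} {p} {x} deg≤1 p∈L ℓp x∈L ℓx with x ≟ p
  ... | yes x≡p = x≡p
  ... | no x≢p = ⊥-elim (ℕP.<⇒≱ two-neighbours deg≤1)
    where
    two-neighbours : 2 ≤ deg L ℓ
    two-neighbours = subst (_≤ deg L ℓ)
      (cong₂ (λ a b → ⟦ a ⟧ + ⟦ b ⟧) (cong₂ _∧_ x∈L ℓx) (cong₂ _∧_ p∈L ℓp))
      (two-terms-≤-∑ (λ j → ⟦ L j ∧ adj G ℓ j ⟧) x≢p)

  find-leaf : ∀ k L → size L ≡ suc (suc k) → vol L ≡ suc k + suc k → ConnectedIn L → Leaf L
  find-leaf k L size≡ vol≡ connected = leaf-at (low-degree-vertex L few-edges)
    where
    few-edges : vol L < size L + size L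
    few-edges rewrite size≡ | vol≡ = s≤s (ℕP.+-monoʳ-≤ (suc k) (ℕP.n≤1+n (suc k)))

    two-members : 2 ≤ size L
    two-members rewrite size≡ = s≤s (s≤s z≤n)

    leaf-at : (∃ λ ℓ → ℓ ∈ L × deg L ℓ ≤ 1) → Leaf L
    leaf-at (ℓ , ℓ∈L , deg≤1) with u , u∈L , u≢ℓ ← another-member L two-members ℓ
      with connected ℓ∈L u∈L
    ... | ε = ⊥-elim (u≢ℓ refl)
    ... | (_ , p∈L , ℓp) ◅ _ = record
      { leaf = ℓ ; stem = _ ; leaf∈ = ℓ∈L ; stem∈ = p∈L ; leaf-stem = ℓp
      ; only-stem = unique-neighbour L deg≤1 p∈L ℓp }

  module LeafRemoval {L : VertexSet n} (lf : Leaf L) where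
    open Leaf lf

    L′ : VertexSet n
    L′ = L ─ leaf

    open Deletion L leaf

    only-stem′ : ∀ {x} → x ∈ L → Adj G x leaf → x ≡ stem
    only-stem′ x∈L xℓ = only-stem x∈L (trans (sym G leaf _) xℓ)

    neighbour-is-stem : ∀ {j} → L j ∧ adj G leaf j ≡ true → j ≡ stem
    neighbour-is-stem e = only-stem (∧-conicalˡ _ _ e) (∧-conicalʳ _ _ e)

    deg-leaf : deg L leaf ≡ 1
    deg-leaf = trans (∑-single stem _ off-stem) at-stem
      where
      off-stem : ∀ j → j ≢ stem → ⟦ L j ∧ adj G leaf j ⟧ ≡ 0
      off-stem j j≢stem with L j ∧ adj G leaf j in e
      ... | false = refl
      ... | true  = ⊥-elim (j≢stem (neighbour-is-stem e))
      at-stem : ⟦ L stem ∧ adj G leaf stem ⟧ ≡ 1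
      at-stem = cong₂ (λ a b → ⟦ a ∧ b ⟧) stem∈ leaf-stem

    size-remove : size L ≡ suc (size L′)
    size-remove = ∑-bump leaf 1 _ _ (λ i i≢ℓ → cong ⟦_⟧ (Eq.sym (─-other i≢ℓ))) at-leaf
      where
      at-leaf : ⟦ L leaf ⟧ ≡ 1 + ⟦ L′ leaf ⟧
      at-leaf = trans (cong ⟦_⟧ leaf∈) (cong (λ b → 1 + ⟦ b ⟧) (Eq.sym ─-self))

    towards-leaf : Fin n → ℕ
    towards-leaf i = ⟦ L i ∧ adj G i leaf ⟧

    ∑-towards-leaf : ∑ towards-leaf ≡ 1
    ∑-towards-leaf = trans (∑-cong (λ i → cong (λ b → ⟦ L i ∧ b ⟧) (sym G i leaf))) deg-leaf

    row-remove : ∀ i → i ≢ leaf → row L i ≡ towards-leaf i + row L′ i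
    row-remove i i≢ℓ = ∑-bump leaf (towards-leaf i) _ _ same at-leaf
      where
      same : ∀ j → j ≢ leaf → ⟦ L i ∧ L j ∧ adj G i j ⟧ ≡ ⟦ L′ i ∧ L′ j ∧ adj G i j ⟧
      same j j≢ℓ = cong₂ (λ a b → ⟦ a ∧ b ∧ adj G i j ⟧) (Eq.sym (─-other i≢ℓ)) (Eq.sym (─-other j≢ℓ))
      at-leaf : ⟦ L i ∧ L leaf ∧ adj G i leaf ⟧ ≡ towards-leaf i + ⟦ L′ i ∧ L′ leaf ∧ adj G i leaf ⟧
      at-leaf = begin
          ⟦ L i ∧ L leaf ∧ adj G i leaf ⟧
        ≡⟨ cong (λ b → ⟦ L i ∧ b ∧ adj G i leaf ⟧) leaf∈ ⟩
          towards-leaf i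
        ≡⟨ ℕP.+-identityʳ _ ⟨
          towards-leaf i + ⟦ false ⟧
        ≡⟨ cong (λ b → towards-leaf i + ⟦ b ⟧) (∧-zeroʳ (L′ i)) ⟨
          towards-leaf i + ⟦ L′ i ∧ false ⟧
        ≡⟨ cong (λ b → towards-leaf i + ⟦ L′ i ∧ b ∧ adj G i leaf ⟧) ─-self ⟨
          towards-leaf i + ⟦ L′ i ∧ L′ leaf ∧ adj G i leaf ⟧
        ∎
        where open ≡-Reasoning

    row-at-leaf : row L leaf ≡ 1 + (towards-leaf leaf + row L′ leaf)
    row-at-leaf = begin
        row L leaf                             ≡⟨ cong (λ b → ∑ (λ j → ⟦ b ∧ L j ∧ adj G leaf j ⟧)) leaf∈ ⟩
        deg L leaf                             ≡⟨ deg-leaf ⟩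
        1                                      ≡⟨ cong suc (cong₂ _+_ no-loop no-row) ⟨
        1 + (towards-leaf leaf + row L′ leaf)  ∎
      where
      open ≡-Reasoning
      no-loop : towards-leaf leaf ≡ 0
      no-loop = trans (cong (λ b → ⟦ L leaf ∧ b ⟧) (irrefl G leaf)) (cong ⟦_⟧ (∧-zeroʳ (L leaf)))
      no-row : row L′ leaf ≡ 0
      no-row = trans (cong (λ b → ∑ (λ j → ⟦ b ∧ L′ j ∧ adj G leaf j ⟧)) ─-self)
                     (∑-zero (λ (_ : Fin n) → 0) (λ _ → refl))

    vol-remove : vol L ≡ 2 + vol L′
    vol-remove = begin
        ∑ (row L)                                  ≡⟨ ∑-bump leaf 1 (row L) _ row-remove row-at-leaf ⟩
        1 + ∑ (λ i → towards-leaf i + row L′ i)    ≡⟨ cong (1 +_) (∑-distrib-+ towards-leaf (row L′)) ⟩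
        1 + (∑ towards-leaf + vol L′)              ≡⟨ cong (λ t → 1 + (t + vol L′)) ∑-towards-leaf ⟩
        2 + vol L′                                 ∎
      where open ≡-Reasoning

    -- A walk in L ending away from the leaf can be rerouted around the leaf, since it
    -- can only enter and leave the leaf through the stem.
    reroute : ∀ {x v} → Star (EdgeIn L) x v → v ≢ leaf →
              (x ≢ leaf → Star (EdgeIn L′) x v) × (x ≡ leaf → Star (EdgeIn L′) stem v)
    reroute ε v≢ℓ = (λ _ → ε) , (λ v≡ℓ → ⊥-elim (v≢ℓ v≡ℓ))
    reroute {x} (_◅_ {j = y} (x∈L , y∈L , xy) walk) v≢ℓ with reroute walk v≢ℓ | y ≟ leaf
    ... | from-y , _ | no y≢ℓ =
      (λ x≢ℓ → (∈-─ x≢ℓ x∈L , ∈-─ y≢ℓ y∈L , xy) ◅ from-y y≢ℓ) ,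
      (λ { refl → subst (λ s → Star (EdgeIn L′) s _) (only-stem y∈L xy) (from-y y≢ℓ) })
    ... | _ , from-leaf | yes refl =
      (λ _ → subst (λ s → Star (EdgeIn L′) s _) (Eq.sym (only-stem′ x∈L xy)) (from-leaf refl)) ,
      (λ { refl → ⊥-elim (adjacent-distinct xy refl) })

    connected-remove : ConnectedIn L → ConnectedIn L′
    connected-remove connected u∈L′ v∈L′
      with u≢ℓ , u∈L ← ∈-─⁻ u∈L′ | v≢ℓ , v∈L ← ∈-─⁻ v∈L′
      with from-other , _ ← reroute (connected u∈L v∈L) v≢ℓ = from-other u≢ℓ

    leaf-weight : ∀ g → Balanced L g → g leaf stem ≡ 0ℚ
    leaf-weight g balanced = trans (Eq.sym flow≡) (balanced leaf∈)
      where
      off-stem : ∀ j → j ≢ stem → (if L j ∧ adj G leaf j then g leaf j else 0ℚ) ≡ 0ℚ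
      off-stem j j≢stem with L j ∧ adj G leaf j in e
      ... | false = refl
      ... | true  = ⊥-elim (j≢stem (neighbour-is-stem e))
      flow≡ : flow L g leaf ≡ g leaf stem
      flow≡ = trans (∑ℚ-single stem _ off-stem)
                    (cong₂ (λ a b → if a ∧ b then g leaf stem else 0ℚ) stem∈ leaf-stem)

    -- deleting the leaf removes only the zero-weight edge, so balance persists
    balanced-remove : ∀ g → Symmetric g → Balanced L g → Balanced L′ g
    balanced-remove g g-sym balanced {i} i∈L′ with i≢ℓ , i∈L ← ∈-─⁻ i∈L′ =
      trans (Σℚ.sum-cong-≗ same-terms) (balanced i∈L)
      where
      leaf-term : 0ℚ ≡ (if adj G i leaf then g i leaf else 0ℚ)
      leaf-term with adj G i leaf in iℓ
      ... | false = refl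
      ... | true  = subst (λ x → 0ℚ ≡ g x leaf) (Eq.sym (only-stem′ i∈L iℓ))
                          (Eq.sym (trans (g-sym stem leaf) (leaf-weight g balanced)))
      same-terms : ∀ j → (if L′ j ∧ adj G i j then g i j else 0ℚ)
                       ≡ (if L j ∧ adj G i j then g i j else 0ℚ)
      same-terms j with j ≟ leaf
      ... | no _     = refl
      ... | yes refl =
        trans leaf-term (cong (λ b → if b ∧ adj G i leaf then g i leaf else 0ℚ) (Eq.sym leaf∈))

    -- an edge of L is either the leaf's edge or an edge of L′
    edges-remove : ∀ g → Symmetric g → Balanced L g →
                   VanishesOnEdgesIn L′ g → VanishesOnEdgesIn L g
    edges-remove g g-sym balanced on-L′ {x} {y} x∈L y∈L xy with x ≟ leaf | y ≟ leaf
    ... | yes refl | _        =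
      subst (λ s → g leaf s ≡ 0ℚ) (Eq.sym (only-stem y∈L xy)) (leaf-weight g balanced)
    ... | no _     | yes refl =
      subst (λ s → g s leaf ≡ 0ℚ) (Eq.sym (only-stem′ x∈L xy))
            (trans (g-sym stem leaf) (leaf-weight g balanced))
    ... | no x≢ℓ   | no y≢ℓ   = on-L′ (∈-─ x≢ℓ x∈L) (∈-─ y≢ℓ y∈L) xy

  balanced-weights-vanish : ∀ g → Symmetric g → ∀ k L →
    size L ≡ suc k → vol L ≡ k + k → ConnectedIn L → Balanced L g → VanishesOnEdgesIn L g
  balanced-weights-vanish g g-sym zero L size≡ _ _ _ {x} {y} x∈L y∈L xy =
    ⊥-elim (ℕP.<⇒≱ two-members (ℕP.≤-reflexive size≡))
    where
    two-members : 2 ≤ size L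
    two-members = subst (_≤ size L) (cong₂ (λ a b → ⟦ a ⟧ + ⟦ b ⟧) x∈L y∈L)
                        (two-terms-≤-∑ (λ i → ⟦ L i ⟧) (adjacent-distinct xy))
  balanced-weights-vanish g g-sym (suc k) L size≡ vol≡ connected balanced =
    edges-remove g g-sym balanced
      (balanced-weights-vanish g g-sym k L′ size′ vol′
         (connected-remove connected) (balanced-remove g g-sym balanced))
    where
    open LeafRemoval (find-leaf k L size≡ vol≡ connected)
    size′ : size L′ ≡ suc k
    size′ = ℕP.suc-injective (trans (Eq.sym size-remove) size≡)
    vol′ : vol L′ ≡ k + k
    vol′ = ℕP.suc-injective (ℕP.suc-injective
             (trans (Eq.sym vol-remove) (trans vol≡ (cong suc (ℕP.+-suc k k)))))

-- For a null vector z, the weights g i j = z i · z j are balanced on the whole graph: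
-- around i they sum to z i · (A z) i = 0.
null-vector-balanced : ∀ {n} (G : Graph n) (z : Fin n → ℚ) → InNullSpace G z →
                       Balanced G full (λ i j → z i *ℚ z j)
null-vector-balanced {n} G z null {i} _ = begin
    Σℚ.sum (λ j → if adj G i j then z i *ℚ z j else 0ℚ)  ≡⟨ Σℚ.sum-cong-≗ pull-out ⟩
    Σℚ.sum (λ j → z i *ℚ Az j)                           ≡⟨ Σℚ.*-distribˡ-sum (z i) Az ⟨
    z i *ℚ Σℚ.sum Az                                     ≡⟨ cong (z i *ℚ_) (sumℚ≡∑ Az) ⟨
    z i *ℚ sumℚ Az                                       ≡⟨ cong (z i *ℚ_) (null i) ⟩
    z i *ℚ 0ℚ                                            ≡⟨ ℚP.*-zeroʳ (z i) ⟩
    0ℚ                                                   ∎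
  where
  open ≡-Reasoning
  Az : Fin n → ℚ
  Az j = adjMatrix G i j *ℚ z j
  pull-out : ∀ j → (if adj G i j then z i *ℚ z j else 0ℚ)
                   ≡ z i *ℚ ((if adj G i j then 1ℚ else 0ℚ) *ℚ z j)
  pull-out j with adj G i j
  ... | true  = cong (z i *ℚ_) (Eq.sym (ℚP.*-identityˡ (z j)))
  ... | false = Eq.sym (trans (cong (z i *ℚ_) (ℚP.*-zeroˡ (z j))) (ℚP.*-zeroʳ (z i)))

tree-null-vector : ∀ {n} (G : Graph n) → IsTree G → (z : Fin n → ℚ) → InNullSpace G z →
                   ∀ {x y} → Adj G x y → z x *ℚ z y ≡ 0ℚ
tree-null-vector {suc k} G (_ , connected , edges) z null =
  balanced-weights-vanish G (λ i j → z i *ℚ z j) (λ i j → ℚP.*-comm (z i) (z j)) k full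
    (∑-ones (suc k)) vol-full connected-full (null-vector-balanced G z null) refl refl
  where
  vol-full : vol G full ≡ k + k
  vol-full = trans (handshake G) (cong₂ _+_ edges edges)
  connected-full : ConnectedIn G full
  connected-full {u} {v} _ _ = Star.map (λ uv → refl , refl , uv) (connected u v)

null-space-+ : ∀ {n} (G : Graph n) {x y : Fin n → ℚ} → InNullSpace G x → InNullSpace G y →
               InNullSpace G (λ i → x i +ℚ y i)
null-space-+ {n} G {x} {y} x-null y-null i = begin
    sumℚ (λ j → A j *ℚ (x j +ℚ y j))
  ≡⟨ sumℚ≡∑ (λ j → A j *ℚ (x j +ℚ y j)) ⟩
    Σℚ.sum (λ j → A j *ℚ (x j +ℚ y j))
  ≡⟨ Σℚ.sum-cong-≗ (λ j → ℚP.*-distribˡ-+ (A j) (x j) (y j)) ⟩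
    Σℚ.sum (λ j → Ax j +ℚ Ay j)
  ≡⟨ Σℚ.∑-distrib-+ Ax Ay ⟩
    Σℚ.sum Ax +ℚ Σℚ.sum Ay
  ≡⟨ cong₂ _+ℚ_ (sumℚ≡∑ Ax) (sumℚ≡∑ Ay) ⟨
    sumℚ Ax +ℚ sumℚ Ay
  ≡⟨ cong₂ _+ℚ_ (x-null i) (y-null i) ⟩
    0ℚ +ℚ 0ℚ
  ≡⟨ ℚP.+-identityˡ 0ℚ ⟩
    0ℚ
  ∎
  where
  open ≡-Reasoning
  A Ax Ay : Fin n → ℚ
  A = adjMatrix G i
  Ax j = A j *ℚ x j
  Ay j = A j *ℚ y j

nonzero-factor : ∀ p q → p ≢ 0ℚ → p *ℚ q ≡ 0ℚ → q ≡ 0ℚ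
nonzero-factor p q p≢0 pq≡0 = begin
    q                      ≡⟨ ℚP.*-identityˡ q ⟨
    1ℚ *ℚ q                ≡⟨ cong (_*ℚ q) (ℚP.*-inverseˡ p) ⟨
    (1/ p *ℚ p) *ℚ q       ≡⟨ ℚP.*-assoc (1/ p) p q ⟩
    1/ p *ℚ (p *ℚ q)       ≡⟨ cong (1/ p *ℚ_) pq≡0 ⟩
    1/ p *ℚ 0ℚ             ≡⟨ ℚP.*-zeroʳ (1/ p) ⟩
    0ℚ                     ∎
  where
  open ≡-Reasoning
  instance _ = ≢-nonZero p≢0

not-nonzero-at-both-ends : ∀ {n} (G : Graph n) → IsTree G → ∀ z → InNullSpace G z →
                           ∀ {w v} → Adj G w v → z w ≢ 0ℚ → z v ≢ 0ℚ → ⊥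
not-nonzero-at-both-ends G tree z z-null wv zw≢0 zv≢0 =
  zv≢0 (nonzero-factor _ _ zw≢0 (tree-null-vector G tree z z-null wv))

-- In a tree, Supp is an independent set: if null vectors x, y are nonzero at adjacent w, v,
-- then one of x, y, x + y is nonzero at both w and v.
supp-independent : ∀ {n} (G : Graph n) → IsTree G →
                   ∀ {w v} → InSupp G w → InSupp G v → Adj G w v → ⊥
supp-independent G tree {w} {v} (x , x-null , xw≢0) (y , y-null , yv≢0) wv
  with x v ≟ℚ 0ℚ | y w ≟ℚ 0ℚ
... | no xv≢0  | _        = not-nonzero-at-both-ends G tree x x-null wv xw≢0 xv≢0
... | yes _    | no yw≢0  = not-nonzero-at-both-ends G tree y y-null wv yw≢0 yv≢0
... | yes xv≡0 | yes yw≡0 =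
  not-nonzero-at-both-ends G tree (λ i → x i +ℚ y i) (null-space-+ G x-null y-null) wv
    (subst (_≢ 0ℚ) (Eq.sym sum-at-w) xw≢0) (subst (_≢ 0ℚ) (Eq.sym sum-at-v) yv≢0)
  where
  sum-at-w : x w +ℚ y w ≡ x w
  sum-at-w = trans (cong (x w +ℚ_) yw≡0) (ℚP.+-identityʳ (x w))
  sum-at-v : x v +ℚ y v ≡ y v
  sum-at-v = trans (cong (_+ℚ y v) xv≡0) (ℚP.+-identityˡ (y v))

mainTheorem18 : ∀ (n : ℕ) (S : Graph n) → IsSTree S →
    ∀ (v : Fin n) → (InCore S v → ¬ InSupp S v) × (¬ InSupp S v → InCore S v)
mainTheorem18 n S (tree , covered) v = core⇒outside-supp , outside-supp⇒core
  where
  core⇒outside-supp : InCore S v → ¬ InSupp S v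
  core⇒outside-supp (w , w∈supp , wv) v∈supp = supp-independent S tree w∈supp v∈supp wv

  outside-supp⇒core : ¬ InSupp S v → InCore S v
  outside-supp⇒core v∉supp with covered v
  ... | w , w∈supp , inj₁ refl = ⊥-elim (v∉supp w∈supp)
  ... | w , w∈supp , inj₂ wv   = w , w∈supp , wv
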